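{- Let $\Pi_1,\Pi_2,\Pi_3$ be three permutations of $[n]=\{1,\dots,n\}$ (viewed as words in which each element of $[n]$ occurs exactly once). Then the word $w=\Pi_1\Pi_2\Pi_3$ (concatenation) $1$-$11$-represents the graph $H$ with vertex set $[n]$ in which distinct $x,y$ are non-adjacent if and only if $x$ and $y$ appear in the same relative order in $\Pi_1$ and in $\Pi_3$, while they appear in the opposite relative order in $\Pi_2$.
   Context: For a word $w$ and letters $x,y$, let $w|_{\{x,y\}}$ be the subsequence of $w$ consisting of all occurrences of $x$ and $y$. A word $w$ over alphabet $V$ (each vertex occurring) $1$-$11$-represents a graph $H=(V,E)$ if for all distinct $x,y\in V$, the total number of occurrences of the factors $xx$ and $yy$ in $w|_{\{x,y\}}$ is at most $1$ if and only if $xy\in E$. -}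

module Defs where

open import Data.Nat using (ℕ; zero; suc; _≤_)
open import Data.Fin using (Fin)
open import Data.Fin.Properties using (_≟_)
open import Data.List using (List; []; _∷_; _++_; [_]; filter; allFin)
open import Data.List.Membership.Propositional using (_∈_)
open import Data.List.Relation.Binary.Permutation.Propositional using (_↭_)
open import Data.Sum using (_⊎_)
open import Data.Product using (_×_; ∃-syntax)
open import Relation.Nullary using (¬_; Dec; yes; no)
open import Relation.Nullary.Decidable using (_⊎-dec_)
open import Relation.Binary.PropositionalEquality using (_≡_)
open import Function.Bundles using (_⇔_)

-- A permutation of [n] = {0,…,n-1} as a word: each element occurs exactly once,
-- i.e. the list is a rearrangement of allFin n.
IsPermWord : ∀ {n} → List (Fin n) → Set
IsPermWord {n} π = π ↭ allFin n

restrict : ∀ {n} → Fin n → Fin n → List (Fin n) → List (Fin n)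
restrict x y = filter (λ z → (z ≟ x) ⊎-dec (z ≟ y))

countFactor : ∀ {n} → Fin n → List (Fin n) → ℕ
countFactor a [] = 0
countFactor a (b ∷ w) = go b w
  where
  go : Fin _ → List (Fin _) → ℕ
  go b [] = 0
  go b (c ∷ w) with b ≟ a | c ≟ a
  ... | yes _ | yes _ = suc (go c w)
  ... | _     | _     = go c w

countXXYY : ∀ {n} → Fin n → Fin n → List (Fin n) → ℕ
countXXYY x y w = countFactor x (restrict x y w) Data.Nat.+ countFactor y (restrict x y w)

Represents-1-11 : ∀ {n} → List (Fin n) → (Fin n → Fin n → Set) → Set
Represents-1-11 {n} w E =
  ((x : Fin n) → x ∈ w) ×
  ((x y : Fin n) → ¬ x ≡ y → (countXXYY x y w ≤ 1) ⇔ E x y)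

Before : ∀ {n} → List (Fin n) → Fin n → Fin n → Set
Before π x y = ∃[ as ] ∃[ bs ] (π ≡ as ++ [ x ] ++ bs × y ∈ bs)

SameOrder : ∀ {n} → List (Fin n) → List (Fin n) → Fin n → Fin n → Set
SameOrder π σ x y = (Before π x y × Before σ x y) ⊎ (Before π y x × Before σ y x)

OppositeOrder : ∀ {n} → List (Fin n) → List (Fin n) → Fin n → Fin n → Set
OppositeOrder π σ x y = (Before π x y × Before σ y x) ⊎ (Before π y x × Before σ x y)

H-adj : ∀ {n} → List (Fin n) → List (Fin n) → List (Fin n) → Fin n → Fin n → Set
H-adj Π₁ Π₂ Π₃ x y = ¬ (SameOrder Π₁ Π₃ x y × OppositeOrder Π₁ Π₂ x y)

-- Restricted to two distinct letters x and y, each permutation reads either xy or yx, so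
-- w|_{x,y} is a concatenation of three such blocks.  A factor xx or yy can only occur at the
-- junction of two consecutive blocks, and it occurs exactly when these blocks have opposite
-- orientations.  Hence w|_{x,y} contains at least two such factors iff Π₂ orders x and y
-- against both Π₁ and Π₃, i.e. iff Π₁ and Π₃ agree on x, y while Π₂ disagrees with Π₁.
module Submission where

open import Defs
open import Data.Bool using (Bool; true; false; if_then_else_; _∧_)
open import Data.Empty using (⊥; ⊥-elim)
open import Data.Fin using (Fin; zero; suc)
open import Data.Fin.Properties using (_≟_)
open import Data.List using (List; []; _∷_; _++_; map; filter)
open import Data.List.Properties using (filter-++; filter-accept; map-++)
open import Data.List.Membership.Propositional using (_∈_)
open import Data.List.Membership.Propositional.Properties using (∈-allFin; ∈-++⁺ˡ; ∈-filter⁺)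
open import Data.List.Relation.Unary.All using (All; []; _∷_)
open import Data.List.Relation.Unary.All.Properties using (all-filter)
open import Data.List.Relation.Unary.AllPairs using ([]; _∷_)
open import Data.List.Relation.Unary.Any using (here; there)
open import Data.List.Relation.Unary.Unique.Propositional using (Unique)
open import Data.List.Relation.Unary.Unique.Propositional.Properties using (allFin⁺; filter⁺)
open import Data.List.Relation.Binary.Permutation.Propositional using (↭-sym; ↭⇒↭ₛ)
open import Data.List.Relation.Binary.Permutation.Propositional.Properties using (∈-resp-↭)
import Data.List.Relation.Binary.Permutation.Setoid.Properties as PermutationSetoid
open import Data.Nat using (ℕ; suc; _+_; _≤_; z≤n; s≤s)
open import Data.Product using (_×_; _,_; proj₁; proj₂; ∃-syntax)
open import Data.Product.Function.NonDependent.Propositional using (_×-⇔_)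
open import Data.Sum as Sum using (_⊎_; inj₁; inj₂; [_,_])
open import Function using (_∘_; id)
open import Function.Bundles using (_⇔_; mk⇔)
open import Function.Construct.Composition using (_⇔-∘_)
open import Function.Construct.Symmetry using (⇔-sym)
open import Function.Definitions using (Injective)
open import Function.Related.TypeIsomorphisms using (¬-cong-⇔)
open import Relation.Nullary using (¬_; does; yes; no)
open import Relation.Nullary.Decidable using (dec-true; dec-false; _⊎-dec_)
open import Relation.Unary using (Decidable)
open import Relation.Binary.PropositionalEquality
  using (_≡_; _≢_; refl; sym; cong; cong₂; subst; setoid; module ≡-Reasoning)

-- countFactor recurses through a helper local to its definition; this is its unfolding.
countFactor-∷-∷ : ∀ {n} (a b c : Fin n) w →
  countFactor a (b ∷ c ∷ w) ≡
    (if does (b ≟ a) ∧ does (c ≟ a) then suc else id) (countFactor a (c ∷ w))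
countFactor-∷-∷ a b c w with b ≟ a | c ≟ a
... | yes _ | yes _ = refl
... | yes _ | no _  = refl
... | no _  | _     = refl

does-≟-injective : ∀ {m n} {f : Fin m → Fin n} → Injective _≡_ _≡_ f →
  ∀ a b → does (f a ≟ f b) ≡ does (a ≟ b)
does-≟-injective {f = f} f-inj a b with a ≟ b
... | yes refl = dec-true (f a ≟ f a) refl
... | no a≢b   = dec-false (f a ≟ f b) (a≢b ∘ f-inj)

countFactor-map : ∀ {m n} {f : Fin m → Fin n} → Injective _≡_ _≡_ f →
  ∀ a w → countFactor (f a) (map f w) ≡ countFactor a w
countFactor-map f-inj a []          = refl
countFactor-map f-inj a (b ∷ [])    = refl
countFactor-map {f = f} f-inj a (b ∷ c ∷ w) = begin
  countFactor (f a) (f b ∷ f c ∷ map f w)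
    ≡⟨ countFactor-∷-∷ (f a) (f b) (f c) (map f w) ⟩
  (if does (f b ≟ f a) ∧ does (f c ≟ f a) then suc else id) (countFactor (f a) (f c ∷ map f w))
    ≡⟨ cong₂ (λ p k → (if p then suc else id) k)
             (cong₂ _∧_ (does-≟-injective f-inj b a) (does-≟-injective f-inj c a))
             (countFactor-map f-inj a (c ∷ w)) ⟩
  (if does (b ≟ a) ∧ does (c ≟ a) then suc else id) (countFactor a (c ∷ w))
    ≡⟨ countFactor-∷-∷ a b c w ⟨
  countFactor a (b ∷ c ∷ w)
    ∎
  where open ≡-Reasoning

filter-++-map : ∀ {A B : Set} {P : A → Set} (P? : Decidable P) {f : B → A} π σ {u v} →
  filter P? π ≡ map f u → filter P? σ ≡ map f v → filter P? (π ++ σ) ≡ map f (u ++ v)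
filter-++-map P? {f} π σ {u} {v} π≡u σ≡v = begin
  filter P? (π ++ σ)           ≡⟨ filter-++ P? π σ ⟩
  filter P? π ++ filter P? σ   ≡⟨ cong₂ _++_ π≡u σ≡v ⟩
  map f u ++ map f v           ≡⟨ map-++ f u v ⟨
  map f (u ++ v)               ∎
  where open ≡-Reasoning

pair-word : {A : Set} {x y : A} {w : List A} → x ≢ y → Unique w →
  All (λ z → z ≡ x ⊎ z ≡ y) w → x ∈ w → y ∈ w → w ≡ x ∷ y ∷ [] ⊎ w ≡ y ∷ x ∷ []
pair-word x≢y _ _ (here refl) (here refl) = ⊥-elim (x≢y refl)
pair-word _ ((a≢b ∷ []) ∷ _) (inj₁ refl ∷ inj₁ refl ∷ []) _ _ = ⊥-elim (a≢b refl)
pair-word _ _                (inj₁ refl ∷ inj₂ refl ∷ []) _ _ = inj₁ refl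
pair-word _ _                (inj₂ refl ∷ inj₁ refl ∷ []) _ _ = inj₂ refl
pair-word _ ((a≢b ∷ []) ∷ _) (inj₂ refl ∷ inj₂ refl ∷ []) _ _ = ⊥-elim (a≢b refl)
pair-word _ ((a≢b ∷ a≢c ∷ _) ∷ (b≢c ∷ _) ∷ _) (inA ∷ inB ∷ inC ∷ _) _ _ =
  ⊥-elim (no-three inA inB inC a≢b a≢c b≢c)
  where
  no-three : ∀ {A : Set} {x y a b c : A} → a ≡ x ⊎ a ≡ y → b ≡ x ⊎ b ≡ y → c ≡ x ⊎ c ≡ y →
             a ≢ b → a ≢ c → b ≢ c → ⊥
  no-three (inj₁ refl) (inj₁ refl) _ a≢b _ _ = a≢b refl
  no-three (inj₂ refl) (inj₂ refl) _ a≢b _ _ = a≢b refl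
  no-three (inj₁ refl) (inj₂ refl) inC _ a≢c b≢c = [ a≢c ∘ sym , b≢c ∘ sym ] inC
  no-three (inj₂ refl) (inj₁ refl) inC _ a≢c b≢c = [ b≢c ∘ sym , a≢c ∘ sym ] inC

Before-∷ : ∀ {n} {π : List (Fin n)} {a c} z → Before π a c → Before (z ∷ π) a c
Before-∷ z (as , bs , π≡ , c∈bs) = z ∷ as , bs , cong (z ∷_) π≡ , c∈bs

Before-total : ∀ {n} {π : List (Fin n)} {a c} → a ∈ π → c ∈ π → a ≢ c → Before π a c ⊎ Before π c a
Before-total (here refl) (here refl) a≢c = ⊥-elim (a≢c refl)
Before-total (here refl) (there c∈π) _   = inj₁ ([] , _ , refl , c∈π)
Before-total (there a∈π) (here refl) _   = inj₂ ([] , _ , refl , a∈π)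
Before-total {π = z ∷ _} (there a∈π) (there c∈π) a≢c =
  Sum.map (Before-∷ z) (Before-∷ z) (Before-total a∈π c∈π a≢c)

Before-filter⁺ : ∀ {n} {P : Fin n → Set} (P? : Decidable P) {π a c} →
  P a → P c → Before π a c → Before (filter P? π) a c
Before-filter⁺ P? {a = a} Pa Pc (as , bs , refl , c∈bs) =
  filter P? as , filter P? bs , filter-accept-middle , ∈-filter⁺ P? c∈bs Pc
  where
  filter-accept-middle : filter P? (as ++ a ∷ bs) ≡ filter P? as ++ a ∷ filter P? bs
  filter-accept-middle rewrite filter-++ P? as (a ∷ bs) | filter-accept P? {xs = bs} Pa = refl

¬Before-pair : ∀ {n} {a c : Fin n} → a ≢ c → ¬ Before (a ∷ c ∷ []) c a
¬Before-pair a≢c ([] , _ , refl , _)            = a≢c refl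
¬Before-pair a≢c (_ ∷ [] , [] , refl , ())
¬Before-pair a≢c (_ ∷ _ ∷ [] , _ , () , _)
¬Before-pair a≢c (_ ∷ _ ∷ _ ∷ _ , _ , () , _)

Ordered : ∀ {n} → List (Fin n) → Fin n → Fin n → Set
Ordered π a c = Before π a c × ¬ Before π c a

filter-pair⇒Ordered : ∀ {n} {P : Fin n → Set} (P? : Decidable P) {π a c} →
  P a → P c → a ≢ c → a ∈ π → c ∈ π → filter P? π ≡ a ∷ c ∷ [] → Ordered π a c
filter-pair⇒Ordered P? {π} {a} {c} Pa Pc a≢c a∈π c∈π filter≡ =
  [ id , ⊥-elim ∘ ¬ca ] (Before-total a∈π c∈π a≢c) , ¬ca
  where
  ¬ca : ¬ Before π c a
  ¬ca ca = ¬Before-pair a≢c (subst (λ w → Before w c a) filter≡ (Before-filter⁺ P? Pc Pa ca))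

-- Words over {x, y} are encoded as words over Fin 2 (x ↦ 0, y ↦ 1), on which countFactor
-- computes by evaluation.
block : Bool → List (Fin 2)
block true  = zero ∷ suc zero ∷ []
block false = suc zero ∷ zero ∷ []

repeats : List (Fin 2) → ℕ
repeats v = countFactor zero v + countFactor (suc zero) v

repeats-≤1⇔ : ∀ b₁ b₂ b₃ → (repeats (block b₁ ++ block b₂ ++ block b₃) ≤ 1) ⇔ (¬ (b₁ ≡ b₃ × b₁ ≢ b₂))
repeats-≤1⇔ true  true  true  = mk⇔ (λ _ (_ , b₁≢b₂) → b₁≢b₂ refl) (λ _ → z≤n)
repeats-≤1⇔ true  true  false = mk⇔ (λ _ (_ , b₁≢b₂) → b₁≢b₂ refl) (λ _ → s≤s z≤n)
repeats-≤1⇔ true  false true  = mk⇔ (λ { (s≤s ()) }) (λ h → ⊥-elim (h (refl , λ ())))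
repeats-≤1⇔ true  false false = mk⇔ (λ _ → λ { (() , _) }) (λ _ → s≤s z≤n)
repeats-≤1⇔ false true  true  = mk⇔ (λ _ → λ { (() , _) }) (λ _ → s≤s z≤n)
repeats-≤1⇔ false true  false = mk⇔ (λ { (s≤s ()) }) (λ h → ⊥-elim (h (refl , λ ())))
repeats-≤1⇔ false false true  = mk⇔ (λ _ (_ , b₁≢b₂) → b₁≢b₂ refl) (λ _ → s≤s z≤n)
repeats-≤1⇔ false false false = mk⇔ (λ _ (_ , b₁≢b₂) → b₁≢b₂ refl) (λ _ → z≤n)

module _ {n} (x y : Fin n) where

  letter : Fin 2 → Fin n
  letter zero       = x
  letter (suc zero) = y

  letter-injective : x ≢ y → Injective _≡_ _≡_ letter
  letter-injective x≢y {zero}     {zero}     _   = refl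
  letter-injective x≢y {zero}     {suc zero} x≡y = ⊥-elim (x≢y x≡y)
  letter-injective x≢y {suc zero} {zero}     y≡x = ⊥-elim (x≢y (sym y≡x))
  letter-injective x≢y {suc zero} {suc zero} _   = refl

  isLetter? : Decidable (λ z → z ≡ x ⊎ z ≡ y)
  isLetter? z = (z ≟ x) ⊎-dec (z ≟ y)

  Oriented : List (Fin n) → Bool → Set
  Oriented π true  = Ordered π x y
  Oriented π false = Ordered π y x

  orientation : ∀ {π} → x ≢ y → Unique π → x ∈ π → y ∈ π →
    ∃[ b ] (restrict x y π ≡ map letter (block b) × Oriented π b)
  orientation {π} x≢y π-unique x∈π y∈π
    with pair-word x≢y (filter⁺ isLetter? π-unique) (all-filter isLetter? π)
                   (∈-filter⁺ isLetter? x∈π (inj₁ refl)) (∈-filter⁺ isLetter? y∈π (inj₂ refl))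
  ... | inj₁ xy = true  , xy , filter-pair⇒Ordered isLetter? (inj₁ refl) (inj₂ refl) x≢y x∈π y∈π xy
  ... | inj₂ yx = false , yx , filter-pair⇒Ordered isLetter? (inj₂ refl) (inj₁ refl) (x≢y ∘ sym) y∈π x∈π yx

  countXXYY-letters : x ≢ y → ∀ w {v} → restrict x y w ≡ map letter v → countXXYY x y w ≡ repeats v
  countXXYY-letters x≢y w {v} restrict≡ rewrite restrict≡ =
    cong₂ _+_ (countFactor-map (letter-injective x≢y) zero v)
              (countFactor-map (letter-injective x≢y) (suc zero) v)

  sameOrder⇔ : ∀ {π σ b c} → Oriented π b → Oriented σ c → SameOrder π σ x y ⇔ (b ≡ c)
  sameOrder⇔ {b = true}  {true}  (πxy , _) (σxy , _) = mk⇔ (λ _ → refl) (λ _ → inj₁ (πxy , σxy))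
  sameOrder⇔ {b = false} {false} (πyx , _) (σyx , _) = mk⇔ (λ _ → refl) (λ _ → inj₂ (πyx , σyx))
  sameOrder⇔ {b = true}  {false} (_ , ¬πyx) (_ , ¬σxy) =
    mk⇔ (⊥-elim ∘ [ ¬σxy ∘ proj₂ , ¬πyx ∘ proj₁ ]) (λ ())
  sameOrder⇔ {b = false} {true}  (_ , ¬πxy) (_ , ¬σyx) =
    mk⇔ (⊥-elim ∘ [ ¬πxy ∘ proj₁ , ¬σyx ∘ proj₂ ]) (λ ())

  oppositeOrder⇔ : ∀ {π σ b c} → Oriented π b → Oriented σ c → OppositeOrder π σ x y ⇔ (b ≢ c)
  oppositeOrder⇔ {b = true}  {false} (πxy , _) (σyx , _) = mk⇔ (λ _ ()) (λ _ → inj₁ (πxy , σyx))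
  oppositeOrder⇔ {b = false} {true}  (πyx , _) (σxy , _) = mk⇔ (λ _ ()) (λ _ → inj₂ (πyx , σxy))
  oppositeOrder⇔ {b = true}  {true}  (_ , ¬πyx) (_ , ¬σyx) =
    mk⇔ (⊥-elim ∘ [ ¬σyx ∘ proj₂ , ¬πyx ∘ proj₁ ]) (λ b≢b → ⊥-elim (b≢b refl))
  oppositeOrder⇔ {b = false} {false} (_ , ¬πxy) (_ , ¬σxy) =
    mk⇔ (⊥-elim ∘ [ ¬πxy ∘ proj₁ , ¬σxy ∘ proj₂ ]) (λ b≢b → ⊥-elim (b≢b refl))

  H-adj⇔ : ∀ {Π₁ Π₂ Π₃ b₁ b₂ b₃} → Oriented Π₁ b₁ → Oriented Π₂ b₂ → Oriented Π₃ b₃ →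
    H-adj Π₁ Π₂ Π₃ x y ⇔ (¬ (b₁ ≡ b₃ × b₁ ≢ b₂))
  H-adj⇔ o₁ o₂ o₃ = ¬-cong-⇔ (sameOrder⇔ o₁ o₃ ×-⇔ oppositeOrder⇔ o₁ o₂)

permWord-∈ : ∀ {n} {π : List (Fin n)} → IsPermWord π → ∀ z → z ∈ π
permWord-∈ π↭ z = ∈-resp-↭ (↭-sym π↭) (∈-allFin z)

permWord-unique : ∀ {n} {π : List (Fin n)} → IsPermWord π → Unique π
permWord-unique {n} π↭ = PermutationSetoid.Unique-resp-↭ (setoid (Fin n)) (↭⇒↭ₛ (↭-sym π↭)) (allFin⁺ n)

mainTheorem2 : (n : ℕ) (Π₁ Π₂ Π₃ : List (Fin n)) →
    IsPermWord Π₁ → IsPermWord Π₂ → IsPermWord Π₃ →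
    Represents-1-11 (Π₁ ++ Π₂ ++ Π₃) (H-adj Π₁ Π₂ Π₃)
mainTheorem2 n Π₁ Π₂ Π₃ Π₁↭ Π₂↭ Π₃↭ = (λ z → ∈-++⁺ˡ (permWord-∈ Π₁↭ z)) , represents
  where
  orient : ∀ {π} x y → x ≢ y → IsPermWord π →
    ∃[ b ] (restrict x y π ≡ map (letter x y) (block b) × Oriented x y π b)
  orient x y x≢y π↭ = orientation x y x≢y (permWord-unique π↭) (permWord-∈ π↭ x) (permWord-∈ π↭ y)

  represents : (x y : Fin n) → x ≢ y → (countXXYY x y (Π₁ ++ Π₂ ++ Π₃) ≤ 1) ⇔ H-adj Π₁ Π₂ Π₃ x y
  represents x y x≢y
    with b₁ , r₁ , o₁ ← orient x y x≢y Π₁↭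
       | b₂ , r₂ , o₂ ← orient x y x≢y Π₂↭
       | b₃ , r₃ , o₃ ← orient x y x≢y Π₃↭
    = subst (λ k → (k ≤ 1) ⇔ H-adj Π₁ Π₂ Π₃ x y) (sym count≡)
            (⇔-sym (H-adj⇔ x y o₁ o₂ o₃) ⇔-∘ repeats-≤1⇔ b₁ b₂ b₃)
    where
    count≡ : countXXYY x y (Π₁ ++ Π₂ ++ Π₃) ≡ repeats (block b₁ ++ block b₂ ++ block b₃)
    count≡ = countXXYY-letters x y x≢y (Π₁ ++ Π₂ ++ Π₃)
               (filter-++-map (isLetter? x y) Π₁ (Π₂ ++ Π₃) r₁ (filter-++-map (isLetter? x y) Π₂ Π₃ r₂ r₃))
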